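{- In any algebra $(A,\to,1)$ of type $(2,0)$: (i) (M) and (BB) imply (B); (ii) (M) and (B) imply (**).
   Context: Properties, for all $x,y,z\in A$: (M) $1\to x=x$; (B) $(y\to z)\to[(x\to y)\to(x\to z)]=1$; (BB) $(y\to z)\to[(z\to x)\to(y\to x)]=1$; (**) $y\to z=1\Rightarrow (z\to x)\to(y\to x)=1$. -}

module Defs where

open import Level using (Level)
open import Relation.Binary.PropositionalEquality using (_≡_)

module _ {a : Level} {A : Set a} (_⇒_ : A → A → A) (𝟏 : A) where

  PropM : Set a
  PropM = ∀ x → (𝟏 ⇒ x) ≡ x

  PropB : Set a
  PropB = ∀ x y z → ((y ⇒ z) ⇒ ((x ⇒ y) ⇒ (x ⇒ z))) ≡ 𝟏

  PropBB : Set a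
  PropBB = ∀ x y z → ((y ⇒ z) ⇒ ((z ⇒ x) ⇒ (y ⇒ x))) ≡ 𝟏

  PropStar : Set a
  PropStar = ∀ x y z → (y ⇒ z) ≡ 𝟏 → ((z ⇒ x) ⇒ (y ⇒ x)) ≡ 𝟏

-- Read x ⇒ y ≡ 𝟏 as x ≤ y. Under (M), (BB) with y = 𝟏 gives z ≤ (z ⇒ x) ⇒ x, and
-- together with modus ponens (BB) makes ≤ transitive and ⇒ antitone in its first
-- argument. Then (B) is the chain
--   y ⇒ z  ≤  ((y ⇒ z) ⇒ (x ⇒ z)) ⇒ (x ⇒ z)  ≤  (x ⇒ y) ⇒ (x ⇒ z),
-- the second step being antitonicity applied to the instance x ⇒ y ≤ (y ⇒ z) ⇒ (x ⇒ z)
-- of (BB). Conversely (**) is (B) with its premise y ⇒ z rewritten to 𝟏 and (M) applied.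
module Submission where

open import Defs
open import Level using (Level)
open import Data.Product using (_×_; _,_)
open import Relation.Binary.PropositionalEquality using (_≡_; sym; trans; subst; cong; cong₂)

module _ {a : Level} {A : Set a} (_⇒_ : A → A → A) (𝟏 : A) (m : PropM _⇒_ 𝟏) where

  modusPonens : ∀ {x y} → (x ⇒ y) ≡ 𝟏 → x ≡ 𝟏 → y ≡ 𝟏
  modusPonens {x} {y} x⇒y≡𝟏 x≡𝟏 = trans (sym (m y)) (subst (λ t → (t ⇒ y) ≡ 𝟏) x≡𝟏 x⇒y≡𝟏)

  propB⇒propStar : PropB _⇒_ 𝟏 → PropStar _⇒_ 𝟏
  propB⇒propStar b x y z y⇒z≡𝟏 =
    subst (λ t → ((z ⇒ x) ⇒ t) ≡ 𝟏) (trans (cong (_⇒ (y ⇒ x)) y⇒z≡𝟏) (m (y ⇒ x))) (b y z x)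

  module _ (bb : PropBB _⇒_ 𝟏) where

    propBB⇒propStar : PropStar _⇒_ 𝟏
    propBB⇒propStar x y z y⇒z≡𝟏 = modusPonens (bb x y z) y⇒z≡𝟏

    ⇒≡𝟏-trans : ∀ {x y z} → (x ⇒ y) ≡ 𝟏 → (y ⇒ z) ≡ 𝟏 → (x ⇒ z) ≡ 𝟏
    ⇒≡𝟏-trans {x} {y} {z} x⇒y≡𝟏 = modusPonens (propBB⇒propStar z x y x⇒y≡𝟏)

    ⇒≡𝟏-apply : ∀ x y → (x ⇒ ((x ⇒ y) ⇒ y)) ≡ 𝟏
    ⇒≡𝟏-apply x y = subst (λ t → t ≡ 𝟏) (cong₂ (λ u v → u ⇒ ((x ⇒ y) ⇒ v)) (m x) (m y)) (bb y 𝟏 x)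

    propBB⇒propB : PropB _⇒_ 𝟏
    propBB⇒propB x y z =
      ⇒≡𝟏-trans (⇒≡𝟏-apply (y ⇒ z) (x ⇒ z))
                (propBB⇒propStar (x ⇒ z) (x ⇒ y) ((y ⇒ z) ⇒ (x ⇒ z)) (bb z x y))

theorem2p6 : ∀ {a : Level} {A : Set a} (_⇒_ : A → A → A) (𝟏 : A)
    → (PropM _⇒_ 𝟏 → PropBB _⇒_ 𝟏 → PropB _⇒_ 𝟏)
    × (PropM _⇒_ 𝟏 → PropB _⇒_ 𝟏 → PropStar _⇒_ 𝟏)
theorem2p6 _⇒_ 𝟏 = propBB⇒propB _⇒_ 𝟏 , propB⇒propStar _⇒_ 𝟏
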